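{- Let $T$ be a tournament. Then: (1) every acyclic autonomous subset of $V(T)$ is contained in an acyclic component of $T$; (2) the acyclic components of $T$ form a partition of $V(T)$ into autonomous subsets; (3) every partition of $V(T)$ into acyclic autonomous subsets is a refinement of the partition into acyclic components.
   Context: A tournament is a set with an irreflexive, antisymmetric, complete binary relation; a subset is acyclic if the induced tournament has no $3$-cycle. A subset $A$ of vertices is autonomous if for all $x,x'\in A$ and $y\notin A$, $(x,y)$ is an edge iff $(x',y)$ is an edge. The acyclic component of $x\in V(T)$ is the union of all acyclic autonomous subsets containing $x$. -}

module Defs where

open import Level using (Level; _⊔_) renaming (suc to lsuc; zero to lzero)
open import Data.Product using (Σ; ∃; ∃-syntax; _×_; _,_)
open import Data.Sum using (_⊎_)
open import Data.Empty using (⊥)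
open import Relation.Nullary using (¬_)
open import Relation.Binary.PropositionalEquality using (_≡_; _≢_)
open import Relation.Unary using (Pred; _∈_; _∉_; _⊆_; _≐_)
open import Function.Bundles using (_⇔_)

record Tournament : Set₁ where
  field
    V      : Set
    E      : V → V → Set
    irrefl : ∀ x → ¬ E x x
    antisym : ∀ x y → E x y → ¬ E y x
    complete : ∀ x y → x ≢ y → E x y ⊎ E y x

module _ (T : Tournament) where
  open Tournament T

  Acyclic : ∀ {ℓ} → Pred V ℓ → Set ℓ
  Acyclic A = ¬ (Σ V λ a → Σ V λ b → Σ V λ c →
                   a ∈ A × b ∈ A × c ∈ A × E a b × E b c × E c a)

  Autonomous : ∀ {ℓ} → Pred V ℓ → Set ℓ
  Autonomous A = ∀ x x' y → x ∈ A → x' ∈ A → y ∉ A → (E x y ⇔ E x' y)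

  AcyclicComponent : V → Pred V (lsuc lzero)
  AcyclicComponent x y =
    Σ (Pred V lzero) λ A → Acyclic A × Autonomous A × x ∈ A × y ∈ A

  IsPartition : ∀ {ℓ} {I : Set} → (I → Pred V ℓ) → Set ℓ
  IsPartition {I = I} B =
    (∀ i → ∃[ x ] x ∈ B i) ×
    (∀ x → ∃[ i ] x ∈ B i) ×
    (∀ i j x → x ∈ B i → x ∈ B j → B i ≐ B j)

-- A 3-cycle cannot have two vertices in an acyclic autonomous set A: the
-- third vertex would lie outside A, and autonomy would force the two edges
-- joining it to A to point the same way.  Hence the union of two acyclic
-- autonomous sets is acyclic, and it is autonomous as soon as they meet.
-- So the acyclic autonomous sets through x are closed under pairwise union,
-- which makes their union, the acyclic component of x, autonomous, and any
-- two components that meet coincide.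
module Submission where

open import Defs
open import Level using (Level; 0ℓ)
open import Data.Product using (∃-syntax; _×_; _,_; proj₁; proj₂)
open import Data.Sum using (inj₁; inj₂)
open import Relation.Nullary using (¬_)
open import Relation.Unary using (Pred; _∈_; _∉_; _⊆_; _∪_; ｛_｝)
open import Relation.Binary.PropositionalEquality using (refl)
open import Function.Bundles using (_⇔_; Equivalence)
import Function.Properties.Equivalence as ⇔

module _ (T : Tournament) where
  open Tournament T

  private
    variable
      ℓ ℓ₁ ℓ₂ : Level

  AcyclicAutonomous : Pred V ℓ → Set ℓ
  AcyclicAutonomous A = Acyclic T A × Autonomous T A

  no-3-cycle-through-two : {A : Pred V ℓ} → AcyclicAutonomous A →
    ∀ {a b c} → a ∈ A → b ∈ A → E a b → E b c → ¬ E c a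
  no-3-cycle-through-two {A = A} (acyclic , autonomous) {a} {b} {c} a∈A b∈A ab bc ca =
    antisym a c (Equivalence.from (autonomous a b c a∈A b∈A c∉A) bc) ca
    where
      c∉A : c ∉ A
      c∉A c∈A = acyclic (a , b , c , a∈A , b∈A , c∈A , ab , bc , ca)

  ∪-acyclic : {A : Pred V ℓ₁} {B : Pred V ℓ₂} →
    AcyclicAutonomous A → AcyclicAutonomous B → Acyclic T (A ∪ B)
  ∪-acyclic A B (a , b , c , inj₁ a∈ , inj₁ b∈ , _ , ab , bc , ca) = no-3-cycle-through-two A a∈ b∈ ab bc ca
  ∪-acyclic A B (a , b , c , inj₂ a∈ , inj₂ b∈ , _ , ab , bc , ca) = no-3-cycle-through-two B a∈ b∈ ab bc ca
  ∪-acyclic A B (a , b , c , _ , inj₁ b∈ , inj₁ c∈ , ab , bc , ca) = no-3-cycle-through-two A b∈ c∈ bc ca ab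
  ∪-acyclic A B (a , b , c , _ , inj₂ b∈ , inj₂ c∈ , ab , bc , ca) = no-3-cycle-through-two B b∈ c∈ bc ca ab
  ∪-acyclic A B (a , b , c , inj₁ a∈ , _ , inj₁ c∈ , ab , bc , ca) = no-3-cycle-through-two A c∈ a∈ ca ab bc
  ∪-acyclic A B (a , b , c , inj₂ a∈ , _ , inj₂ c∈ , ab , bc , ca) = no-3-cycle-through-two B c∈ a∈ ca ab bc

  ∪-autonomous : {A : Pred V ℓ₁} {B : Pred V ℓ₂} → Autonomous T A → Autonomous T B →
    ∀ {p} → p ∈ A → p ∈ B → Autonomous T (A ∪ B)
  ∪-autonomous {A = A} {B} autA autB {p} p∈A p∈B x x' y x∈ x'∈ y∉ =
    ⇔.trans (edge-as-p x x∈) (⇔.sym (edge-as-p x' x'∈))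
    where
      edge-as-p : ∀ u → u ∈ A ∪ B → E u y ⇔ E p y
      edge-as-p u (inj₁ u∈A) = autA u p y u∈A p∈A (λ y∈A → y∉ (inj₁ y∈A))
      edge-as-p u (inj₂ u∈B) = autB u p y u∈B p∈B (λ y∈B → y∉ (inj₂ y∈B))

  ∪-acyclicAutonomous : {A : Pred V ℓ₁} {B : Pred V ℓ₂} →
    AcyclicAutonomous A → AcyclicAutonomous B →
    ∀ {p} → p ∈ A → p ∈ B → AcyclicAutonomous (A ∪ B)
  ∪-acyclicAutonomous A B p∈A p∈B =
    ∪-acyclic A B , ∪-autonomous (proj₂ A) (proj₂ B) p∈A p∈B

  singleton-acyclicAutonomous : ∀ x → AcyclicAutonomous ｛ x ｝
  singleton-acyclicAutonomous x =
    (λ { (a , _ , _ , refl , refl , refl , aa , _) → irrefl a aa })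
    , λ { _ _ _ refl refl _ → ⇔.refl }

  ⊆-acyclicComponent : {A : Pred V 0ℓ} → AcyclicAutonomous A →
    ∀ {x} → x ∈ A → A ⊆ AcyclicComponent T x
  ⊆-acyclicComponent (acyclic , autonomous) x∈A y∈A =
    _ , acyclic , autonomous , x∈A , y∈A

  ∈-acyclicComponent : ∀ x → x ∈ AcyclicComponent T x
  ∈-acyclicComponent x =
    ⊆-acyclicComponent (singleton-acyclicAutonomous x) refl refl

  acyclicComponent-mono : ∀ {x y z} → z ∈ AcyclicComponent T x → z ∈ AcyclicComponent T y →
    AcyclicComponent T x ⊆ AcyclicComponent T y
  acyclicComponent-mono (A₁ , ac₁ , au₁ , x∈A₁ , z∈A₁) (A₂ , ac₂ , au₂ , y∈A₂ , z∈A₂)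
                        (A , ac , au , x∈A , w∈A) =
    ⊆-acyclicComponent A∪A₁∪A₂ (inj₂ y∈A₂) (inj₁ (inj₁ w∈A))
    where
      A∪A₁ = ∪-acyclicAutonomous (ac , au) (ac₁ , au₁) x∈A x∈A₁
      A∪A₁∪A₂ = ∪-acyclicAutonomous A∪A₁ (ac₂ , au₂) (inj₂ z∈A₁) z∈A₂

  acyclicComponent-autonomous : ∀ x → Autonomous T (AcyclicComponent T x)
  acyclicComponent-autonomous x u u' y (A , ac , au , x∈A , u∈A) (A' , ac' , au' , x∈A' , u'∈A') y∉ =
    ⇔.trans (au u x y u∈A x∈A (λ y∈A → y∉ (A , ac , au , x∈A , y∈A)))
            (au' x u' y x∈A' u'∈A' (λ y∈A' → y∉ (A' , ac' , au' , x∈A' , y∈A')))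

  acyclicComponent-partition : IsPartition T (AcyclicComponent T)
  acyclicComponent-partition =
    (λ x → x , ∈-acyclicComponent x) ,
    (λ x → x , ∈-acyclicComponent x) ,
    λ x y z z∈x z∈y → acyclicComponent-mono z∈x z∈y , acyclicComponent-mono z∈y z∈x

lemma3p4 : (T : Tournament) →
    let open Tournament T in
    ((A : Pred V 0ℓ) → Acyclic T A → Autonomous T A → (∃[ a ] a ∈ A) →
    ∃[ x ] (A ⊆ AcyclicComponent T x))
    × (IsPartition T (AcyclicComponent T) × (∀ x → Autonomous T (AcyclicComponent T x)))
    × ((I : Set) (B : I → Pred V 0ℓ) → IsPartition T B →
    (∀ i → Acyclic T (B i) × Autonomous T (B i)) →
    ∀ i → ∃[ x ] (B i ⊆ AcyclicComponent T x))
lemma3p4 T =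
  contained-in-component ,
  (acyclicComponent-partition T , acyclicComponent-autonomous T) ,
  λ I B (nonempty , _) acyclicAutonomous i →
    contained-in-component (B i) (proj₁ (acyclicAutonomous i)) (proj₂ (acyclicAutonomous i)) (nonempty i)
  where
    open Tournament T
    contained-in-component : (A : Pred V 0ℓ) → Acyclic T A → Autonomous T A →
      ∃[ a ] a ∈ A → ∃[ x ] (A ⊆ AcyclicComponent T x)
    contained-in-component A acyclic autonomous (a , a∈A) =
      a , ⊆-acyclicComponent T (acyclic , autonomous) a∈A
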